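{- The comparison of two chocolate bars in partisan chocolate game displays the following patterns. (i1a) If $n$, $m$ and $m'$ are nonnegative integers such that $n+m$ and $n+m'$ are even, and $m\geqslant m'$, then $(n,m)\succcurlyeq (n,m')$. (i1b) Analogously, if $n$, $n'$ and $m$ are nonnegative integers such that $n+m$ and $n'+m$ are even and $n\geqslant n'$, then $(n,m)\succcurlyeq (n',m)$. (i2a) If $n$, $m$ and $m'$ are nonnegative integers such that $n+m$ and $n+m'$ are odd, and $m\geqslant m'$, then $(n,m)\preccurlyeq (n,m')$. (i2b) Analogously, if $n$, $n'$ and $m$ are nonnegative integers such that $n+m$ and $n'+m$ are odd and $n\geqslant n'$, then $(n,m)\preccurlyeq (n',m)$. (iia) If $n$, $m$ and $m'$ are nonnegative integers such that $n+m$ is odd and $n+m'$ is even, then $(n,m)\succcurlyeq (n,m')$. (iib) Analogously, if $n$, $n'$ and $m$ are nonnegative integers such that $n+m$ is odd and $n'+m$ is even, then $(n,m)\succcurlyeq (n',m)$. (iiia) If $n$, $m$, $n'$ and $m'$ are nonnegative integers such that $n+m=n'+m'$ are odd, then $(n,m)= (n',m')$. (iiib) Analogously, if $n$, $m$, $n'$ and $m'$ are nonnegative integers such that $n+m=n'+m'$ are even and $|n-n'|$ is even, then $(n,m)= (n',m')$.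
   Context: Partisan chocolate game: a component is a rectangular chocolate bar of square cells; the bottom-left cell is poisoned (black), the others are colored blue and red in checkerboard fashion with the cells orthogonally adjacent to the poisoned one blue. Left may cut along a vertical line if the top square of the column immediately to the right of that line is blue, or along a horizontal line if the rightmost square of the row just above that line is blue; Right may make the same moves when the corresponding square is red. After a cut, the player eats the portion not containing the poisoned square. Normal play (the player who cannot move loses); several bars are combined by disjunctive sum. The bar with $n+1$ columns and $m+1$ rows is denoted $(n,m)$ (columns and rows indexed from 0), so its top-right square is blue iff $n+m$ is odd and red iff $n+m$ is even. $G\succcurlyeq H$ means $o(G+X)\geqslant o(H+X)$ for all positions $X$ (outcomes ordered from Left's perspective), and $=$ denotes game equivalence. -}

module Defs where

open import Data.Nat using (ℕ; zero; suc; _+_)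
open import Data.Bool using (Bool; true; false; not; _∨_; if_then_else_)
open import Data.List using (List; []; _∷_; _++_; upTo; concatMap)
open import Data.Product using (_×_)
open import Relation.Binary.PropositionalEquality using (_≡_)

-- Short combinatorial games (normal play): a game is given by its
-- list of Left options and its list of Right options.

data Game : Set where
  ⟨_∣_⟩ : List Game → List Game → Game

mutual
  _⊕_ : Game → Game → Game
  ⟨ gl ∣ gr ⟩ ⊕ ⟨ hl ∣ hr ⟩ =
    ⟨ (gl ⊕ᴸ ⟨ hl ∣ hr ⟩) ++ (⟨ gl ∣ gr ⟩ ᴿ⊕ hl)
    ∣ (gr ⊕ᴸ ⟨ hl ∣ hr ⟩) ++ (⟨ gl ∣ gr ⟩ ᴿ⊕ hr) ⟩

  _⊕ᴸ_ : List Game → Game → List Game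
  [] ⊕ᴸ h = []
  (g ∷ gs) ⊕ᴸ h = (g ⊕ h) ∷ (gs ⊕ᴸ h)

  _ᴿ⊕_ : Game → List Game → List Game
  g ᴿ⊕ [] = []
  g ᴿ⊕ (h ∷ hs) = (g ⊕ h) ∷ (g ᴿ⊕ hs)

infixl 6 _⊕_

mutual
  leftWinsFirst : Game → Bool
  leftWinsFirst ⟨ gl ∣ gr ⟩ = someRightLoses gl

  rightWinsFirst : Game → Bool
  rightWinsFirst ⟨ gl ∣ gr ⟩ = someLeftLoses gr

  someRightLoses : List Game → Bool
  someRightLoses [] = false
  someRightLoses (g ∷ gs) = not (rightWinsFirst g) ∨ someRightLoses gs

  someLeftLoses : List Game → Bool
  someLeftLoses [] = false
  someLeftLoses (g ∷ gs) = not (leftWinsFirst g) ∨ someLeftLoses gs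

data Outcome : Set where
  𝓛 𝓝 𝓟 𝓡 : Outcome

outcome : Game → Outcome
outcome g with leftWinsFirst g | rightWinsFirst g
... | true  | true  = 𝓝
... | true  | false = 𝓛
... | false | true  = 𝓡
... | false | false = 𝓟

data _≥ₒ_ : Outcome → Outcome → Set where
  refl≥ : ∀ {o} → o ≥ₒ o
  𝓛≥𝓝 : 𝓛 ≥ₒ 𝓝
  𝓛≥𝓟 : 𝓛 ≥ₒ 𝓟
  𝓛≥𝓡 : 𝓛 ≥ₒ 𝓡
  𝓝≥𝓡 : 𝓝 ≥ₒ 𝓡
  𝓟≥𝓡 : 𝓟 ≥ₒ 𝓡

_≽_ : Game → Game → Set
g ≽ h = ∀ (x : Game) → outcome (g ⊕ x) ≥ₒ outcome (h ⊕ x)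

_≈_ : Game → Game → Set
g ≈ h = (g ≽ h) × (h ≽ g)

-- Partisan chocolate bars.
-- Cell (i , j) (column i, row j; (0,0) poisoned) is blue iff i + j is odd,
-- red iff i + j is even (i + j > 0).

isOdd : ℕ → Bool
isOdd zero = false
isOdd (suc n) = not (isOdd n)

-- barF f n m : game of the bar (n , m) (n+1 columns, m+1 rows), computed
-- with fuel f; correct whenever f ≥ n + m (each move strictly lowers n + m).
-- Vertical cut left of column k (1 ≤ k ≤ n): deciding square (k , m),
--   result (k-1 , m).  Horizontal cut below row j (1 ≤ j ≤ m): deciding
--   square (n , j), result (n , j-1).  Left moves if blue, Right if red.
barF : ℕ → ℕ → ℕ → Game
barF zero n m = ⟨ [] ∣ [] ⟩
barF (suc f) n m =
  ⟨ concatMap (λ i → if isOdd (suc i + m) then barF f i m ∷ [] else []) (upTo n)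
    ++ concatMap (λ j → if isOdd (n + suc j) then barF f n j ∷ [] else []) (upTo m)
  ∣ concatMap (λ i → if isOdd (suc i + m) then [] else barF f i m ∷ []) (upTo n)
    ++ concatMap (λ j → if isOdd (n + suc j) then [] else barF f n j ∷ []) (upTo m) ⟩

bar : ℕ → ℕ → Game
bar n m = barF (n + m) n m

-- Give each bar (n , m) a rank: bars with n + m odd (blue top-right square) rank
-- above all bars with n + m even, among themselves the smaller n + m the better
-- for Left; bars with n + m even are ranked by n + m + 2·[n even], the larger
-- the better.  A Left move strictly lowers the rank and a Right move strictly
-- raises it, and whenever one rank exceeds another, either the first bar has a
-- Left move or the second a Right move that does not cross the other rank.  By
-- simultaneous induction, rank ≥ then gives Conway's G ≥ H and rank > gives
-- G ⧐ H.  Conway's order is compatible with disjunctive sums and comparison with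
-- 0 determines who wins moving first, so G ≥ H implies G ≽ H.  Each of the eight
-- statements is a comparison of ranks.
module Submission where

open import Defs
open import Data.Nat using (ℕ; zero; suc; _+_; _*_; _≤_; _<_; _≥_; z≤n; s≤s; ∣_-_∣)
open import Data.Nat.Properties
open import Data.Nat.Divisibility using (_∣_; divides)
open import Data.Bool using (true; false; not; if_then_else_)
open import Data.Bool.Properties using (not-involutive; not-injective; not-¬; ¬-not; ∨-zeroʳ)
open import Data.Product using (_×_; _,_; ∃₂)
open import Data.Sum using (_⊎_; inj₁; inj₂)
open import Data.Empty using (⊥; ⊥-elim)
open import Data.List using (List; []; _∷_; concatMap; upTo)
open import Data.List.Relation.Unary.All as All using (All; []; _∷_)
import Data.List.Relation.Unary.All.Properties as Allₚ
open import Data.List.Relation.Unary.Any using (Any; here; there)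
import Data.List.Relation.Unary.Any.Properties as Anyₚ
open import Function using (id)
open import Relation.Nullary using (¬_; contradiction)
open import Relation.Binary.Definitions using (tri<; tri≈; tri>)
open import Relation.Binary.PropositionalEquality
  using (_≡_; refl; sym; trans; cong; cong₂; subst; subst₂; module ≡-Reasoning)
open ≡-Reasoning

lefts rights : Game → List Game
lefts ⟨ gl ∣ _ ⟩ = gl
rights ⟨ _ ∣ gr ⟩ = gr

-- Conway's G ≥ H, defined together with G ⧐ H, read as “G ≰ H”.
mutual
  data _≥ᴳ_ (G H : Game) : Set where
    ge : All (G ⧐_) (lefts H) → All (_⧐ H) (rights G) → G ≥ᴳ H

  data _⧐_ (G H : Game) : Set where
    leftOption  : Any (_≥ᴳ H) (lefts G) → G ⧐ H
    rightOption : Any (G ≥ᴳ_) (rights H) → G ⧐ H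

infix 4 _≥ᴳ_ _⧐_

mutual
  ≥ᴳ-trans : ∀ {A B C} → A ≥ᴳ B → B ≥ᴳ C → A ≥ᴳ C
  ≥ᴳ-trans A≥B@(ge _ aR) B≥C@(ge bL _) = ge (All-≥ᴳ-⧐ A≥B bL) (All-⧐-≥ᴳ aR B≥C)

  ≥ᴳ-⧐-trans : ∀ {A B C} → A ≥ᴳ B → B ⧐ C → A ⧐ C
  ≥ᴳ-⧐-trans (ge aL _) (leftOption p) = All⧐-Any≥ᴳ aL p
  ≥ᴳ-⧐-trans A≥B (rightOption p) = rightOption (≥ᴳ-Any≥ᴳ A≥B p)

  ⧐-≥ᴳ-trans : ∀ {A B C} → A ⧐ B → B ≥ᴳ C → A ⧐ C
  ⧐-≥ᴳ-trans (leftOption p) B≥C = leftOption (Any≥ᴳ-≥ᴳ p B≥C)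
  ⧐-≥ᴳ-trans (rightOption p) (ge _ bR) = Any≥ᴳ-All⧐ p bR

  All-≥ᴳ-⧐ : ∀ {A B cs} → A ≥ᴳ B → All (B ⧐_) cs → All (A ⧐_) cs
  All-≥ᴳ-⧐ A≥B [] = []
  All-≥ᴳ-⧐ A≥B (p ∷ ps) = ≥ᴳ-⧐-trans A≥B p ∷ All-≥ᴳ-⧐ A≥B ps

  All-⧐-≥ᴳ : ∀ {B C as} → All (_⧐ B) as → B ≥ᴳ C → All (_⧐ C) as
  All-⧐-≥ᴳ [] B≥C = []
  All-⧐-≥ᴳ (p ∷ ps) B≥C = ⧐-≥ᴳ-trans p B≥C ∷ All-⧐-≥ᴳ ps B≥C

  ≥ᴳ-Any≥ᴳ : ∀ {A B cs} → A ≥ᴳ B → Any (B ≥ᴳ_) cs → Any (A ≥ᴳ_) cs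
  ≥ᴳ-Any≥ᴳ A≥B (here p) = here (≥ᴳ-trans A≥B p)
  ≥ᴳ-Any≥ᴳ A≥B (there p) = there (≥ᴳ-Any≥ᴳ A≥B p)

  Any≥ᴳ-≥ᴳ : ∀ {B C as} → Any (_≥ᴳ B) as → B ≥ᴳ C → Any (_≥ᴳ C) as
  Any≥ᴳ-≥ᴳ (here p) B≥C = here (≥ᴳ-trans p B≥C)
  Any≥ᴳ-≥ᴳ (there p) B≥C = there (Any≥ᴳ-≥ᴳ p B≥C)

  All⧐-Any≥ᴳ : ∀ {A C bs} → All (A ⧐_) bs → Any (_≥ᴳ C) bs → A ⧐ C
  All⧐-Any≥ᴳ (p ∷ _) (here q) = ⧐-≥ᴳ-trans p q
  All⧐-Any≥ᴳ (_ ∷ ps) (there q) = All⧐-Any≥ᴳ ps q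

  Any≥ᴳ-All⧐ : ∀ {A C bs} → Any (A ≥ᴳ_) bs → All (_⧐ C) bs → A ⧐ C
  Any≥ᴳ-All⧐ (here q) (p ∷ _) = ≥ᴳ-⧐-trans q p
  Any≥ᴳ-All⧐ (there q) (_ ∷ ps) = Any≥ᴳ-All⧐ q ps

mutual
  ⊕-monoˡ-≥ᴳ : ∀ {G H} → G ≥ᴳ H → ∀ X → G ⊕ X ≥ᴳ H ⊕ X
  ⊕-monoˡ-≥ᴳ {⟨ gl ∣ gr ⟩} {⟨ hl ∣ hr ⟩} G≥H@(ge hL⧐ ⧐hR) X@(⟨ xl ∣ xr ⟩) =
    ge (Allₚ.++⁺ (All-⧐-⊕ᴸ hL⧐ X)
                (All.map (λ p → leftOption (Anyₚ.++⁺ʳ (gl ⊕ᴸ X) p)) (ᴿ⊕-dominatedˡ G≥H xl)))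
       (Allₚ.++⁺ (All-⧐-⊕ᴸ′ ⧐hR X)
                (All.map (λ p → rightOption (Anyₚ.++⁺ʳ (hr ⊕ᴸ X) p)) (ᴿ⊕-dominatedʳ G≥H xr)))

  ⊕-monoˡ-⧐ : ∀ {G H} → G ⧐ H → ∀ X → G ⊕ X ⧐ H ⊕ X
  ⊕-monoˡ-⧐ {⟨ _ ∣ _ ⟩} {⟨ _ ∣ _ ⟩} (leftOption p) X@(⟨ _ ∣ _ ⟩) =
    leftOption (Anyₚ.++⁺ˡ (Any-≥ᴳ-⊕ᴸ p X))
  ⊕-monoˡ-⧐ {⟨ _ ∣ _ ⟩} {⟨ _ ∣ _ ⟩} (rightOption p) X@(⟨ _ ∣ _ ⟩) =
    rightOption (Anyₚ.++⁺ˡ (Any-≥ᴳ-⊕ᴸ′ p X))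

  All-⧐-⊕ᴸ : ∀ {G hs} → All (G ⧐_) hs → ∀ X → All (G ⊕ X ⧐_) (hs ⊕ᴸ X)
  All-⧐-⊕ᴸ [] X = []
  All-⧐-⊕ᴸ (p ∷ ps) X = ⊕-monoˡ-⧐ p X ∷ All-⧐-⊕ᴸ ps X

  All-⧐-⊕ᴸ′ : ∀ {H gs} → All (_⧐ H) gs → ∀ X → All (_⧐ H ⊕ X) (gs ⊕ᴸ X)
  All-⧐-⊕ᴸ′ [] X = []
  All-⧐-⊕ᴸ′ (p ∷ ps) X = ⊕-monoˡ-⧐ p X ∷ All-⧐-⊕ᴸ′ ps X

  Any-≥ᴳ-⊕ᴸ : ∀ {H gs} → Any (_≥ᴳ H) gs → ∀ X → Any (_≥ᴳ H ⊕ X) (gs ⊕ᴸ X)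
  Any-≥ᴳ-⊕ᴸ (here p) X = here (⊕-monoˡ-≥ᴳ p X)
  Any-≥ᴳ-⊕ᴸ (there p) X = there (Any-≥ᴳ-⊕ᴸ p X)

  Any-≥ᴳ-⊕ᴸ′ : ∀ {G hs} → Any (G ≥ᴳ_) hs → ∀ X → Any (G ⊕ X ≥ᴳ_) (hs ⊕ᴸ X)
  Any-≥ᴳ-⊕ᴸ′ (here p) X = here (⊕-monoˡ-≥ᴳ p X)
  Any-≥ᴳ-⊕ᴸ′ (there p) X = there (Any-≥ᴳ-⊕ᴸ′ p X)

  ᴿ⊕-dominatedˡ : ∀ {G H} → G ≥ᴳ H → ∀ xs → All (λ y → Any (_≥ᴳ y) (G ᴿ⊕ xs)) (H ᴿ⊕ xs)
  ᴿ⊕-dominatedˡ G≥H [] = []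
  ᴿ⊕-dominatedˡ G≥H (x ∷ xs) = here (⊕-monoˡ-≥ᴳ G≥H x) ∷ All.map there (ᴿ⊕-dominatedˡ G≥H xs)

  ᴿ⊕-dominatedʳ : ∀ {G H} → G ≥ᴳ H → ∀ xs → All (λ y → Any (y ≥ᴳ_) (H ᴿ⊕ xs)) (G ᴿ⊕ xs)
  ᴿ⊕-dominatedʳ G≥H [] = []
  ᴿ⊕-dominatedʳ G≥H (x ∷ xs) = here (⊕-monoˡ-≥ᴳ G≥H x) ∷ All.map there (ᴿ⊕-dominatedʳ G≥H xs)

𝟎 : Game
𝟎 = ⟨ [] ∣ [] ⟩

mutual
  leftWinsFirst⇒⧐𝟎 : ∀ G → leftWinsFirst G ≡ true → G ⧐ 𝟎
  leftWinsFirst⇒⧐𝟎 ⟨ gl ∣ _ ⟩ e = leftOption (someRightLoses⇒Any≥𝟎 gl e)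

  someRightLoses⇒Any≥𝟎 : ∀ gs → someRightLoses gs ≡ true → Any (_≥ᴳ 𝟎) gs
  someRightLoses⇒Any≥𝟎 (g ∷ gs) e with rightWinsFirst g in r
  ... | false = here (rightLosesFirst⇒≥𝟎 g r)
  ... | true  = there (someRightLoses⇒Any≥𝟎 gs e)

  rightLosesFirst⇒≥𝟎 : ∀ G → rightWinsFirst G ≡ false → G ≥ᴳ 𝟎
  rightLosesFirst⇒≥𝟎 ⟨ _ ∣ gr ⟩ e = ge [] (noLeftLoses⇒All⧐𝟎 gr e)

  noLeftLoses⇒All⧐𝟎 : ∀ gs → someLeftLoses gs ≡ false → All (_⧐ 𝟎) gs
  noLeftLoses⇒All⧐𝟎 [] e = []
  noLeftLoses⇒All⧐𝟎 (g ∷ gs) e with leftWinsFirst g in l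
  ... | true = leftWinsFirst⇒⧐𝟎 g l ∷ noLeftLoses⇒All⧐𝟎 gs e

mutual
  ⧐𝟎⇒leftWinsFirst : ∀ G → G ⧐ 𝟎 → leftWinsFirst G ≡ true
  ⧐𝟎⇒leftWinsFirst ⟨ gl ∣ _ ⟩ (leftOption p) = Any≥𝟎⇒someRightLoses gl p

  Any≥𝟎⇒someRightLoses : ∀ gs → Any (_≥ᴳ 𝟎) gs → someRightLoses gs ≡ true
  Any≥𝟎⇒someRightLoses (g ∷ gs) (here p) rewrite ≥𝟎⇒rightLosesFirst g p = refl
  Any≥𝟎⇒someRightLoses (g ∷ gs) (there p) rewrite Any≥𝟎⇒someRightLoses gs p = ∨-zeroʳ _

  ≥𝟎⇒rightLosesFirst : ∀ G → G ≥ᴳ 𝟎 → rightWinsFirst G ≡ false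
  ≥𝟎⇒rightLosesFirst ⟨ _ ∣ gr ⟩ (ge _ p) = All⧐𝟎⇒noLeftLoses gr p

  All⧐𝟎⇒noLeftLoses : ∀ gs → All (_⧐ 𝟎) gs → someLeftLoses gs ≡ false
  All⧐𝟎⇒noLeftLoses [] [] = refl
  All⧐𝟎⇒noLeftLoses (g ∷ gs) (p ∷ ps)
    rewrite ⧐𝟎⇒leftWinsFirst g p | All⧐𝟎⇒noLeftLoses gs ps = refl

outcome-mono : ∀ G H → (leftWinsFirst H ≡ true → leftWinsFirst G ≡ true)
             → (rightWinsFirst H ≡ false → rightWinsFirst G ≡ false) → outcome G ≥ₒ outcome H
outcome-mono G H L R with leftWinsFirst G | rightWinsFirst G | leftWinsFirst H | rightWinsFirst H
... | true  | true  | true  | true  = refl≥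
... | true  | true  | false | true  = 𝓝≥𝓡
... | true  | false | true  | true  = 𝓛≥𝓝
... | true  | false | true  | false = refl≥
... | true  | false | false | true  = 𝓛≥𝓡
... | true  | false | false | false = 𝓛≥𝓟
... | false | true  | false | true  = refl≥
... | false | false | false | true  = 𝓟≥𝓡
... | false | false | false | false = refl≥
... | _     | true  | _     | false = contradiction (R refl) λ ()
... | false | _     | true  | _     = contradiction (L refl) λ ()

≥ᴳ⇒≽ : ∀ {G H} → G ≥ᴳ H → G ≽ H
≥ᴳ⇒≽ {G} {H} G≥H X = outcome-mono (G ⊕ X) (H ⊕ X)
  (λ l → ⧐𝟎⇒leftWinsFirst (G ⊕ X) (≥ᴳ-⧐-trans G+X≥H+X (leftWinsFirst⇒⧐𝟎 (H ⊕ X) l)))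
  (λ r → ≥𝟎⇒rightLosesFirst (G ⊕ X) (≥ᴳ-trans G+X≥H+X (rightLosesFirst⇒≥𝟎 (H ⊕ X) r)))
  where G+X≥H+X = ⊕-monoˡ-≥ᴳ G≥H X

Even Odd : ℕ → Set
Even k = isOdd k ≡ false
Odd k = isOdd k ≡ true

isOdd-+-cancelˡ : ∀ m {n n′} → isOdd (m + n) ≡ isOdd (m + n′) → isOdd n ≡ isOdd n′
isOdd-+-cancelˡ zero p = p
isOdd-+-cancelˡ (suc m) p = isOdd-+-cancelˡ m (not-injective p)

isOdd-+-cancelʳ : ∀ n n′ m → isOdd (n + m) ≡ isOdd (n′ + m) → isOdd n ≡ isOdd n′
isOdd-+-cancelʳ n n′ m p =
  isOdd-+-cancelˡ m (subst₂ (λ a b → isOdd a ≡ isOdd b) (+-comm n m) (+-comm n′ m) p)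

isOdd-2+ : ∀ k → isOdd (2 + k) ≡ isOdd k
isOdd-2+ k = not-involutive (isOdd k)

isOdd-+-suc : ∀ n j → isOdd (n + suc j) ≡ not (isOdd (n + j))
isOdd-+-suc n j = cong isOdd (+-suc n j)

Odd⇒1≤ : ∀ {k} → Odd k → 1 ≤ k
Odd⇒1≤ {suc _} _ = s≤s z≤n

parity-gap : ∀ {s t} → isOdd s ≡ isOdd t → s < t → 2 + s ≤ t
parity-gap p s<t = ≤∧≢⇒< s<t λ { refl → not-¬ refl p }

2∣⇒Even : ∀ {k} → 2 ∣ k → Even k
2∣⇒Even (divides q refl) = Even-*2 q
  where
  Even-*2 : ∀ q → Even (q * 2)
  Even-*2 zero = refl
  Even-*2 (suc q) = trans (isOdd-2+ (q * 2)) (Even-*2 q)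

Even⇒2∣ : ∀ k → Even k → 2 ∣ k
Even⇒2∣ zero _ = divides 0 refl
Even⇒2∣ (suc (suc k)) e with Even⇒2∣ k (trans (sym (isOdd-2+ k)) e)
... | divides q refl = divides (suc q) refl

¬2∣⇒Odd : ∀ {k} → ¬ 2 ∣ k → Odd k
¬2∣⇒Odd {k} ∤k = ¬-not λ e → ∤k (Even⇒2∣ k e)

Even-∣-∣⇒isOdd≡ : ∀ n n′ → Even ∣ n - n′ ∣ → isOdd n ≡ isOdd n′
Even-∣-∣⇒isOdd≡ zero n′ e = sym e
Even-∣-∣⇒isOdd≡ (suc n) zero e = e
Even-∣-∣⇒isOdd≡ (suc n) (suc n′) e = cong not (Even-∣-∣⇒isOdd≡ n n′ e)

evenBonus : ℕ → ℕ
evenBonus n = if isOdd n then 0 else 2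

data Rank : Set where
  blue red : ℕ → Rank

rank : ℕ → ℕ → Rank
rank n m = if isOdd (n + m) then blue (n + m) else red (n + m + evenBonus n)

data _≥ʳ_ : Rank → Rank → Set where
  red≥red   : ∀ {i j} → j ≤ i → red i ≥ʳ red j
  blue≥red  : ∀ {s j} → blue s ≥ʳ red j
  blue≥blue : ∀ {s t} → s ≤ t → blue s ≥ʳ blue t

data _>ʳ_ : Rank → Rank → Set where
  red>red   : ∀ {i j} → j < i → red i >ʳ red j
  blue>red  : ∀ {s j} → blue s >ʳ red j
  blue>blue : ∀ {s t} → s < t → blue s >ʳ blue t

infix 4 _≥ʳ_ _>ʳ_

≥ʳ-reflexive : ∀ {r r′} → r ≡ r′ → r ≥ʳ r′
≥ʳ-reflexive {red _} refl = red≥red ≤-refl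
≥ʳ-reflexive {blue _} refl = blue≥blue ≤-refl

≥ʳ->ʳ-trans : ∀ {r r′ r″} → r ≥ʳ r′ → r′ >ʳ r″ → r >ʳ r″
≥ʳ->ʳ-trans (red≥red j≤i) (red>red k<j) = red>red (<-≤-trans k<j j≤i)
≥ʳ->ʳ-trans blue≥red (red>red _) = blue>red
≥ʳ->ʳ-trans (blue≥blue _) blue>red = blue>red
≥ʳ->ʳ-trans (blue≥blue s≤t) (blue>blue t<u) = blue>blue (≤-<-trans s≤t t<u)

>ʳ-≥ʳ-trans : ∀ {r r′ r″} → r >ʳ r′ → r′ ≥ʳ r″ → r >ʳ r″
>ʳ-≥ʳ-trans (red>red j<i) (red≥red k≤j) = red>red (≤-<-trans k≤j j<i)
>ʳ-≥ʳ-trans blue>red (red≥red _) = blue>red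
>ʳ-≥ʳ-trans (blue>blue _) blue≥red = blue>red
>ʳ-≥ʳ-trans (blue>blue s<t) (blue≥blue t≤u) = blue>blue (<-≤-trans s<t t≤u)

rank-odd : ∀ n m → Odd (n + m) → rank n m ≡ blue (n + m)
rank-odd n m o rewrite o = refl

rank-even : ∀ n m → Even (n + m) → rank n m ≡ red (n + m + evenBonus n)
rank-even n m e rewrite e = refl

evenBonus-cong : ∀ n n′ → isOdd n ≡ isOdd n′ → evenBonus n ≡ evenBonus n′
evenBonus-cong _ _ = cong (if_then 0 else 2)

evenBonus-Even : ∀ {n} → Even n → evenBonus n ≡ 2
evenBonus-Even = cong (if_then 0 else 2)

evenBonus≤2 : ∀ n → evenBonus n ≤ 2
evenBonus≤2 n with isOdd n
... | true = z≤n
... | false = ≤-refl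

isOdd-+-evenBonus : ∀ k n → isOdd (k + evenBonus n) ≡ isOdd k
isOdd-+-evenBonus k n with isOdd n
... | true = cong isOdd (+-identityʳ k)
... | false = trans (cong isOdd (+-comm k 2)) (isOdd-2+ k)

red-rank-≥2 : ∀ n m → Even (n + m) → 2 ≤ n + m + evenBonus n
red-rank-≥2 zero m _ = m≤n+m 2 m
red-rank-≥2 (suc n) (suc m) _ = ≤-trans (+-mono-≤ (s≤s (z≤n {n})) (s≤s (z≤n {m}))) (m≤m+n _ _)
red-rank-≥2 (suc n) zero e rewrite +-identityʳ n | e = m≤n+m 2 (suc n)

data Cut (n m : ℕ) : ℕ → ℕ → Set where
  vertical   : ∀ {i} → i < n → Cut n m i m
  horizontal : ∀ {j} → j < m → Cut n m n j

cut-< : ∀ {n m a b} → Cut n m a b → a + b < n + m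
cut-< {m = m} (vertical i<n) = +-monoˡ-< m i<n
cut-< {n = n} (horizontal j<m) = +-monoʳ-< n j<m

cut-isOdd-column : ∀ {n m a b} → Cut n m a b → isOdd (a + b) ≡ isOdd (n + m) → isOdd a ≡ isOdd n
cut-isOdd-column {n} {m} {a} (vertical _) p = isOdd-+-cancelʳ a n m p
cut-isOdd-column (horizontal _) _ = refl

rank>red : ∀ n m {j} → (Even (n + m) → j < n + m + evenBonus n) → rank n m >ʳ red j
rank>red n m j< with isOdd (n + m)
... | true = blue>red
... | false = red>red (j< refl)

blue>rank : ∀ n m {s} → (Odd (n + m) → s < n + m) → blue s >ʳ rank n m
blue>rank n m s< with isOdd (n + m)
... | true = blue>blue (s< refl)
... | false = blue>red

rank-left : ∀ {n m a b} → Cut n m a b → Even (a + b) → rank n m >ʳ rank a b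
rank-left {n} {m} {a} {b} c e = subst (rank n m >ʳ_) (sym (rank-even a b e)) (rank>red n m λ e′ →
  +-mono-<-≤ (cut-< c) (≤-reflexive (evenBonus-cong a n (cut-isOdd-column c (trans e (sym e′))))))

rank-right : ∀ {n m a b} → Cut n m a b → Odd (a + b) → rank a b >ʳ rank n m
rank-right {n} {m} {a} {b} c o =
  subst (_>ʳ rank n m) (sym (rank-odd a b o)) (blue>rank n m λ _ → cut-< c)

LeftOption RightOption : ℕ → ℕ → (Rank → Set) → Set
LeftOption n m Q = ∃₂ λ a b → Cut n m a b × Even (a + b) × Q (rank a b)
RightOption n m Q = ∃₂ λ a b → Cut n m a b × Odd (a + b) × Q (rank a b)

cut-by-one : ∀ n m → 1 ≤ n + m → ∃₂ λ a b → Cut n m a b × suc (a + b) ≡ n + m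
cut-by-one (suc n) m _ = n , m , vertical (n<1+n n) , refl
cut-by-one zero (suc m) _ = zero , m , horizontal (n<1+n m) , refl

cut-to-even-column : ∀ n m → Odd (n + m) → ∃₂ λ a b → Cut n m a b × suc (a + b) ≡ n + m × Even a
cut-to-even-column n m o with isOdd n in p
cut-to-even-column (suc n) m o | true = n , m , vertical (n<1+n n) , refl , not-injective p
cut-to-even-column n (suc m) o | false = n , m , horizontal (n<1+n m) , sym (+-suc n m) , p
cut-to-even-column n zero o | false = contradiction (trans (sym (subst Odd (+-identityʳ n) o)) p) λ ()
cut-to-even-column zero m o | true = contradiction p λ ()

cut-by-two : ∀ n m → 2 ≤ n ⊎ 2 ≤ m → ∃₂ λ a b → Cut n m a b × 2 + (a + b) ≡ n + m × isOdd a ≡ isOdd n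
cut-by-two (suc (suc n)) m (inj₁ (s≤s (s≤s _))) =
  n , m , vertical (m<n⇒m<1+n (n<1+n n)) , refl , sym (isOdd-2+ n)
cut-by-two (suc zero) _ (inj₁ (s≤s ()))
cut-by-two n (suc (suc m)) (inj₂ (s≤s (s≤s _))) =
  n , m , horizontal (m<n⇒m<1+n (n<1+n m)) , sym (trans (+-suc n (suc m)) (cong suc (+-suc n m))) , refl

2≤-coordinate-of-sum : ∀ n m → 3 ≤ n + m → 2 ≤ n ⊎ 2 ≤ m
2≤-coordinate-of-sum (suc (suc _)) _ _ = inj₁ (s≤s (s≤s z≤n))
2≤-coordinate-of-sum _ (suc (suc _)) _ = inj₂ (s≤s (s≤s z≤n))
2≤-coordinate-of-sum 0 0 ()
2≤-coordinate-of-sum 0 1 (s≤s ())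
2≤-coordinate-of-sum 1 0 (s≤s ())
2≤-coordinate-of-sum 1 1 (s≤s (s≤s ()))

2≤-coordinate-of-red-rank : ∀ n m → 4 ≤ n + m + evenBonus n → 2 ≤ n ⊎ 2 ≤ m
2≤-coordinate-of-red-rank (suc (suc _)) _ _ = inj₁ (s≤s (s≤s z≤n))
2≤-coordinate-of-red-rank _ (suc (suc _)) _ = inj₂ (s≤s (s≤s z≤n))
2≤-coordinate-of-red-rank 0 0 (s≤s (s≤s ()))
2≤-coordinate-of-red-rank 0 1 (s≤s (s≤s (s≤s ())))
2≤-coordinate-of-red-rank 1 0 (s≤s ())
2≤-coordinate-of-red-rank 1 1 (s≤s (s≤s ()))

even-right-option : ∀ {n m s} → Even (n + m) → s < n + m → RightOption n m (blue s ≥ʳ_)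
even-right-option {n} {m} {s} e s<n+m with cut-by-one n m (≤-trans (s≤s z≤n) s<n+m)
... | a , b , c , eq =
  a , b , c , o , subst (blue s ≥ʳ_) (sym (rank-odd a b o))
    (blue≥blue (≤-pred (subst (suc s ≤_) (sym eq) s<n+m)))
  where
  o : Odd (a + b)
  o = not-injective (trans (cong isOdd eq) e)

odd-left-option : ∀ {n m j} → Odd (n + m) → j ≤ suc (n + m) → LeftOption n m (_≥ʳ red j)
odd-left-option {n} {m} {j} o j≤ with cut-to-even-column n m o
... | a , b , c , eq , ea =
  a , b , c , e , subst (_≥ʳ red j) (sym (rank-even a b e)) (red≥red j≤a+b+evenBonus)
  where
  e : Even (a + b)
  e = not-injective (trans (cong isOdd eq) o)
  j≤a+b+evenBonus : j ≤ a + b + evenBonus a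
  j≤a+b+evenBonus = subst (λ c → j ≤ a + b + c) (sym (evenBonus-Even {a} ea))
    (subst (j ≤_) (+-comm 2 (a + b)) (subst (λ k → j ≤ suc k) (sym eq) j≤))

odd-right-option : ∀ {n m s} → Odd (n + m) → 1 ≤ s → 2 + s ≤ n + m → RightOption n m (blue s ≥ʳ_)
odd-right-option {n} {m} {s} o 1≤s 2+s≤
  with cut-by-two n m (2≤-coordinate-of-sum n m (≤-trans (+-monoʳ-≤ 2 1≤s) 2+s≤))
... | a , b , c , eq , _ =
  a , b , c , o′ , subst (blue s ≥ʳ_) (sym (rank-odd a b o′))
    (blue≥blue (+-cancelˡ-≤ 2 s (a + b) (subst (2 + s ≤_) (sym eq) 2+s≤)))
  where
  o′ : Odd (a + b)
  o′ = trans (sym (isOdd-2+ (a + b))) (trans (cong isOdd eq) o)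

even-left-option : ∀ {n m j} → Even (n + m) → 2 ≤ j → 2 + j ≤ n + m + evenBonus n
                 → LeftOption n m (_≥ʳ red j)
even-left-option {n} {m} {j} e 2≤j 2+j≤
  with cut-by-two n m (2≤-coordinate-of-red-rank n m (≤-trans (+-monoʳ-≤ 2 2≤j) 2+j≤))
... | a , b , c , eq , column =
  a , b , c , e′ , subst (_≥ʳ red j) (sym (rank-even a b e′))
    (red≥red (+-cancelˡ-≤ 2 j (a + b + evenBonus a)
      (subst₂ (λ s c → 2 + j ≤ s + c) (sym eq) (evenBonus-cong n a (sym column)) 2+j≤)))
  where
  e′ : Even (a + b)
  e′ = trans (sym (isOdd-2+ (a + b))) (trans (cong isOdd eq) e)

rank-gap : ∀ n m n′ m′ → rank n m >ʳ rank n′ m′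
         → LeftOption n m (_≥ʳ rank n′ m′) ⊎ RightOption n′ m′ (rank n m ≥ʳ_)
rank-gap n m n′ m′ r with isOdd (n + m) in p | isOdd (n′ + m′) in p′
rank-gap n m n′ m′ (blue>blue s<t) | true | true =
  inj₂ (odd-right-option p′ (Odd⇒1≤ p) (parity-gap (trans p (sym p′)) s<t))
rank-gap n m n′ m′ blue>red | true | false with <-cmp (n + m) (n′ + m′)
... | tri< s<t _ _ = inj₂ (even-right-option p′ s<t)
... | tri≈ _ s≡t _ = contradiction (trans (sym p) (trans (cong isOdd s≡t) p′)) λ ()
... | tri> _ _ t<s = inj₁ (odd-left-option p
  (≤-trans (+-monoʳ-≤ (n′ + m′) (evenBonus≤2 n′)) (subst (_≤ suc (n + m)) (+-comm 2 (n′ + m′)) (s≤s t<s))))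
rank-gap n m n′ m′ (red>red j<i) | false | false =
  inj₁ (even-left-option p (red-rank-≥2 n′ m′ p′) (parity-gap red-ranks-even j<i))
  where
  red-ranks-even : isOdd (n′ + m′ + evenBonus n′) ≡ isOdd (n + m + evenBonus n)
  red-ranks-even = trans (isOdd-+-evenBonus (n′ + m′) n′)
    (trans p′ (sym (trans (isOdd-+-evenBonus (n + m) n) p)))

-- The square deciding a cut that leaves (a , b) has coordinate sum a + b + 1, so
-- Left's cuts are exactly those leaving a bar with a + b even.
module _ {P : Game → Set} where

  private
    All-if : ∀ {b x} → (b ≡ true → P x) → All P (if b then x ∷ [] else [])
    All-if {true} p = p refl ∷ []
    All-if {false} _ = []

    All-if-not : ∀ {b x} → (b ≡ false → P x) → All P (if b then [] else x ∷ [])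
    All-if-not {true} _ = []
    All-if-not {false} p = p refl ∷ []

    Any-if : ∀ {b x} → b ≡ true → P x → Any P (if b then x ∷ [] else [])
    Any-if refl p = here p

    Any-if-not : ∀ {b x} → b ≡ false → P x → Any P (if b then [] else x ∷ [])
    Any-if-not refl p = here p

    All-concatMap-upTo : ∀ {h : ℕ → List Game} n → (∀ {i} → i < n → All P (h i))
                       → All P (concatMap h (upTo n))
    All-concatMap-upTo n p = Allₚ.concat⁺ (Allₚ.map⁺ (Allₚ.applyUpTo⁺₁ id n p))

    Any-concatMap-upTo : ∀ {h : ℕ → List Game} {i n} → i < n → Any P (h i)
                       → Any P (concatMap h (upTo n))
    Any-concatMap-upTo {h} i<n p = Anyₚ.concatMap⁺ h (Anyₚ.applyUpTo⁺ id p i<n)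

  All-lefts-barF : ∀ f n m → (∀ {a b} → Cut n m a b → Even (a + b) → P (barF f a b))
                 → All P (lefts (barF (suc f) n m))
  All-lefts-barF f n m p = Allₚ.++⁺
    (All-concatMap-upTo n λ i<n → All-if λ o → p (vertical i<n) (not-injective o))
    (All-concatMap-upTo m λ {j} j<m → All-if λ o →
      p (horizontal j<m) (not-injective (trans (sym (isOdd-+-suc n j)) o)))

  All-rights-barF : ∀ f n m → (∀ {a b} → Cut n m a b → Odd (a + b) → P (barF f a b))
                  → All P (rights (barF (suc f) n m))
  All-rights-barF f n m p = Allₚ.++⁺
    (All-concatMap-upTo n λ i<n → All-if-not λ e → p (vertical i<n) (not-injective e))
    (All-concatMap-upTo m λ {j} j<m → All-if-not λ e →
      p (horizontal j<m) (not-injective (trans (sym (isOdd-+-suc n j)) e)))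

  Any-lefts-barF : ∀ f {n m a b} → Cut n m a b → Even (a + b) → P (barF f a b)
                 → Any P (lefts (barF (suc f) n m))
  Any-lefts-barF f (vertical i<n) e p = Anyₚ.++⁺ˡ (Any-concatMap-upTo i<n (Any-if (cong not e) p))
  Any-lefts-barF f {n} (horizontal {j} j<m) e p = Anyₚ.++⁺ʳ _
    (Any-concatMap-upTo j<m (Any-if (trans (isOdd-+-suc n j) (cong not e)) p))

  Any-rights-barF : ∀ f {n m a b} → Cut n m a b → Odd (a + b) → P (barF f a b)
                  → Any P (rights (barF (suc f) n m))
  Any-rights-barF f (vertical i<n) o p = Anyₚ.++⁺ˡ (Any-concatMap-upTo i<n (Any-if-not (cong not o) p))
  Any-rights-barF f {n} (horizontal {j} j<m) o p = Anyₚ.++⁺ʳ _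
    (Any-concatMap-upTo j<m (Any-if-not (trans (isOdd-+-suc n j) (cong not o)) p))

cut-fuel : ∀ {f n m a b} → Cut n m a b → n + m ≤ suc f → a + b ≤ f
cut-fuel c n+m≤ = ≤-pred (≤-trans (cut-< c) n+m≤)

no-cut-without-fuel : ∀ {n m a b} → Cut n m a b → n + m ≤ 0 → ⊥
no-cut-without-fuel c n+m≤0 = n≮0 (<-≤-trans (cut-< c) n+m≤0)

mutual
  rank≥⇒barF≥ᴳ : ∀ f g {n m n′ m′} → n + m ≤ f → n′ + m′ ≤ g → rank n m ≥ʳ rank n′ m′
               → barF f n m ≥ᴳ barF g n′ m′
  rank≥⇒barF≥ᴳ f g fuel fuel′ r = ge (lefts-⧐ f g fuel fuel′ r) (rights-⧐ f g fuel fuel′ r)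

  lefts-⧐ : ∀ f g {n m n′ m′} → n + m ≤ f → n′ + m′ ≤ g → rank n m ≥ʳ rank n′ m′
          → All (barF f n m ⧐_) (lefts (barF g n′ m′))
  lefts-⧐ f zero _ _ _ = []
  lefts-⧐ f (suc g) {n′ = n′} {m′} fuel fuel′ r = All-lefts-barF g n′ m′ λ c e →
    rank>⇒barF⧐ f g fuel (cut-fuel c fuel′) (≥ʳ->ʳ-trans r (rank-left c e))

  rights-⧐ : ∀ f g {n m n′ m′} → n + m ≤ f → n′ + m′ ≤ g → rank n m ≥ʳ rank n′ m′
           → All (_⧐ barF g n′ m′) (rights (barF f n m))
  rights-⧐ zero g _ _ _ = []
  rights-⧐ (suc f) g {n} {m} fuel fuel′ r = All-rights-barF f n m λ c o →
    rank>⇒barF⧐ f g (cut-fuel c fuel) fuel′ (>ʳ-≥ʳ-trans (rank-right c o) r)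

  rank>⇒barF⧐ : ∀ f g {n m n′ m′} → n + m ≤ f → n′ + m′ ≤ g → rank n m >ʳ rank n′ m′
              → barF f n m ⧐ barF g n′ m′
  rank>⇒barF⧐ f g {n} {m} {n′} {m′} fuel fuel′ r = option⇒⧐ f g fuel fuel′ (rank-gap n m n′ m′ r)

  option⇒⧐ : ∀ f g {n m n′ m′} → n + m ≤ f → n′ + m′ ≤ g
           → LeftOption n m (_≥ʳ rank n′ m′) ⊎ RightOption n′ m′ (rank n m ≥ʳ_)
           → barF f n m ⧐ barF g n′ m′
  option⇒⧐ zero g fuel _ (inj₁ (_ , _ , c , _)) = ⊥-elim (no-cut-without-fuel c fuel)
  option⇒⧐ (suc f) g fuel fuel′ (inj₁ (_ , _ , c , e , r)) =
    leftOption (Any-lefts-barF f c e (rank≥⇒barF≥ᴳ f g (cut-fuel c fuel) fuel′ r))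
  option⇒⧐ f zero _ fuel′ (inj₂ (_ , _ , c , _)) = ⊥-elim (no-cut-without-fuel c fuel′)
  option⇒⧐ f (suc g) fuel fuel′ (inj₂ (_ , _ , c , o , r)) =
    rightOption (Any-rights-barF g c o (rank≥⇒barF≥ᴳ f g fuel (cut-fuel c fuel′) r))

bar-≽ : ∀ n m n′ m′ → rank n m ≥ʳ rank n′ m′ → bar n m ≽ bar n′ m′
bar-≽ n m n′ m′ r = ≥ᴳ⇒≽ (rank≥⇒barF≥ᴳ (n + m) (n′ + m′) ≤-refl ≤-refl r)

bar-≈ : ∀ n m n′ m′ → rank n m ≡ rank n′ m′ → bar n m ≈ bar n′ m′
bar-≈ n m n′ m′ r≡r′ =
  bar-≽ n m n′ m′ (≥ʳ-reflexive r≡r′) , bar-≽ n′ m′ n m (≥ʳ-reflexive (sym r≡r′))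

even-bar-mono : ∀ n m n′ m′ → Even (n + m) → Even (n′ + m′) → isOdd n ≡ isOdd n′ → n′ + m′ ≤ n + m
              → bar n m ≽ bar n′ m′
even-bar-mono n m n′ m′ e e′ p le = bar-≽ n m n′ m′
  (subst₂ _≥ʳ_ (sym (rank-even n m e)) (sym (rank-even n′ m′ e′))
    (red≥red (+-mono-≤ le (≤-reflexive (evenBonus-cong n′ n (sym p))))))

odd-bar-antitone : ∀ n m n′ m′ → Odd (n + m) → Odd (n′ + m′) → n + m ≤ n′ + m′ → bar n m ≽ bar n′ m′
odd-bar-antitone n m n′ m′ o o′ le = bar-≽ n m n′ m′
  (subst₂ _≥ʳ_ (sym (rank-odd n m o)) (sym (rank-odd n′ m′ o′)) (blue≥blue le))

odd-bar-≽-even-bar : ∀ n m n′ m′ → Odd (n + m) → Even (n′ + m′) → bar n m ≽ bar n′ m′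
odd-bar-≽-even-bar n m n′ m′ o e = bar-≽ n m n′ m′
  (subst₂ _≥ʳ_ (sym (rank-odd n m o)) (sym (rank-even n′ m′ e)) blue≥red)

odd-bar-≈ : ∀ n m n′ m′ → n + m ≡ n′ + m′ → Odd (n + m) → bar n m ≈ bar n′ m′
odd-bar-≈ n m n′ m′ eq o = bar-≈ n m n′ m′ (begin
  rank n m       ≡⟨ rank-odd n m o ⟩
  blue (n + m)   ≡⟨ cong blue eq ⟩
  blue (n′ + m′) ≡⟨ rank-odd n′ m′ (subst Odd eq o) ⟨
  rank n′ m′     ∎)

even-bar-≈ : ∀ n m n′ m′ → n + m ≡ n′ + m′ → Even (n + m) → isOdd n ≡ isOdd n′ → bar n m ≈ bar n′ m′
even-bar-≈ n m n′ m′ eq e p = bar-≈ n m n′ m′ (begin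
  rank n m                     ≡⟨ rank-even n m e ⟩
  red (n + m + evenBonus n)    ≡⟨ cong₂ (λ s c → red (s + c)) eq (evenBonus-cong n n′ p) ⟩
  red (n′ + m′ + evenBonus n′) ≡⟨ rank-even n′ m′ (subst Even eq e) ⟨
  rank n′ m′                   ∎)

theorem3 :
    -- (i1a)
    (∀ n m m′ → 2 ∣ n + m → 2 ∣ n + m′ → m ≥ m′ → bar n m ≽ bar n m′)
    -- (i1b)
    × (∀ n n′ m → 2 ∣ n + m → 2 ∣ n′ + m → n ≥ n′ → bar n m ≽ bar n′ m)
    -- (i2a)
    × (∀ n m m′ → ¬ 2 ∣ n + m → ¬ 2 ∣ n + m′ → m ≥ m′ → bar n m′ ≽ bar n m)
    -- (i2b)
    × (∀ n n′ m → ¬ 2 ∣ n + m → ¬ 2 ∣ n′ + m → n ≥ n′ → bar n′ m ≽ bar n m)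
    -- (iia)
    × (∀ n m m′ → ¬ 2 ∣ n + m → 2 ∣ n + m′ → bar n m ≽ bar n m′)
    -- (iib)
    × (∀ n n′ m → ¬ 2 ∣ n + m → 2 ∣ n′ + m → bar n m ≽ bar n′ m)
    -- (iiia)
    × (∀ n m n′ m′ → n + m ≡ n′ + m′ → ¬ 2 ∣ n + m → bar n m ≈ bar n′ m′)
    -- (iiib)
    × (∀ n m n′ m′ → n + m ≡ n′ + m′ → 2 ∣ n + m → 2 ∣ ∣ n - n′ ∣
         → bar n m ≈ bar n′ m′)
theorem3 =
    (λ n m m′ 2∣ 2∣′ m≥m′ →
      even-bar-mono n m n m′ (2∣⇒Even 2∣) (2∣⇒Even 2∣′) refl (+-monoʳ-≤ n m≥m′))
  , (λ n n′ m 2∣ 2∣′ n≥n′ →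
      even-bar-mono n m n′ m (2∣⇒Even 2∣) (2∣⇒Even 2∣′)
        (isOdd-+-cancelʳ n n′ m (trans (2∣⇒Even 2∣) (sym (2∣⇒Even 2∣′)))) (+-monoˡ-≤ m n≥n′))
  , (λ n m m′ ∤ ∤′ m≥m′ → odd-bar-antitone n m′ n m (¬2∣⇒Odd ∤′) (¬2∣⇒Odd ∤) (+-monoʳ-≤ n m≥m′))
  , (λ n n′ m ∤ ∤′ n≥n′ → odd-bar-antitone n′ m n m (¬2∣⇒Odd ∤′) (¬2∣⇒Odd ∤) (+-monoˡ-≤ m n≥n′))
  , (λ n m m′ ∤ 2∣ → odd-bar-≽-even-bar n m n m′ (¬2∣⇒Odd ∤) (2∣⇒Even 2∣))
  , (λ n n′ m ∤ 2∣ → odd-bar-≽-even-bar n m n′ m (¬2∣⇒Odd ∤) (2∣⇒Even 2∣))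
  , (λ n m n′ m′ eq ∤ → odd-bar-≈ n m n′ m′ eq (¬2∣⇒Odd ∤))
  , (λ n m n′ m′ eq 2∣ 2∣∣n-n′∣ →
      even-bar-≈ n m n′ m′ eq (2∣⇒Even 2∣) (Even-∣-∣⇒isOdd≡ n n′ (2∣⇒Even 2∣∣n-n′∣)))
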